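{- Let $G$ be a graph with $n$ vertices and let $t$ be a positive integer. Then: (1) $F(G \square P_t) \geq \max\left\{ tF(G),\ n\left\lceil \frac{t-2}{2} \right\rceil \right\}$; (2) if $t \geq 3$, $F(G \square C_t) \geq \max\left\{ tF(G),\ n\left\lfloor \frac{t}{2} \right\rfloor \right\}$; (3) $F(G \square K_t) \geq \max\left\{ tF(G),\ n(t-2) \right\}$.
   Context: All graphs are simple, finite and undirected. $P_t$, $C_t$, $K_t$ denote the path, cycle and complete graph on $t$ vertices. The Cartesian product $G \square H$ has vertex set $V(G)\times V(H)$, with $(u,v)$ adjacent to $(u',v')$ iff either $u=u'$ and $vv'\in E(H)$, or $v=v'$ and $uu'\in E(G)$. Zero forcing: each vertex is blue or white; starting from an initial set $S$ of blue vertices, repeatedly apply the color-change rule: if a blue vertex $u$ has exactly one white neighbor $v$, color $v$ blue. $S$ is a zero forcing set if eventually all vertices are blue, and a failed zero forcing set otherwise. The failed zero forcing number $F(G)$ is the maximum cardinality of a failed zero forcing set of $G$. -}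

module Defs where

open import Data.Nat using (ℕ; zero; suc; _≤_; s≤s; z≤n)
open import Data.Bool using (Bool; true; false; _∧_; _∨_; not)
open import Data.Bool.Properties using (∨-comm)
open import Data.Fin using (Fin; toℕ; remQuot)
open import Data.Fin.Subset using (Subset; _∈_; _∉_; _∪_; ⁅_⁆; ⊤; ∣_∣)
open import Data.Product using (_×_; _,_; ∃; ∃-syntax; proj₁; proj₂)
open import Relation.Nullary using (¬_)
open import Relation.Binary.PropositionalEquality using (_≡_; refl; cong; cong₂)
open import Relation.Binary.Construct.Closure.ReflexiveTransitive using (Star)

eqᵇ : ℕ → ℕ → Bool
eqᵇ zero zero = true
eqᵇ zero (suc _) = false
eqᵇ (suc _) zero = false
eqᵇ (suc m) (suc n) = eqᵇ m n

eqᵇ-sym : ∀ m n → eqᵇ m n ≡ eqᵇ n m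
eqᵇ-sym zero zero = refl
eqᵇ-sym zero (suc n) = refl
eqᵇ-sym (suc m) zero = refl
eqᵇ-sym (suc m) (suc n) = eqᵇ-sym m n

eqᵇ-refl : ∀ m → eqᵇ m m ≡ true
eqᵇ-refl zero = refl
eqᵇ-refl (suc m) = eqᵇ-refl m

eqᵇ-suc : ∀ m → eqᵇ (suc m) m ≡ false
eqᵇ-suc zero = refl
eqᵇ-suc (suc m) = eqᵇ-suc m

record Graph (n : ℕ) : Set where
  field
    adj    : Fin n → Fin n → Bool
    sym    : ∀ u v → adj u v ≡ adj v u
    irrefl : ∀ u → adj u u ≡ false
open Graph public using (adj)

data Force {n : ℕ} (G : Graph n) (S : Subset n) : Subset n → Set where
  force : ∀ u v → u ∈ S → v ∉ S → adj G u v ≡ true →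
          (∀ w → adj G u w ≡ true → w ∉ S → w ≡ v) →
          Force G S (S ∪ ⁅ v ⁆)

ZeroForcingSet : ∀ {n} → Graph n → Subset n → Set
ZeroForcingSet G S = Star (Force G) S ⊤

FailedZeroForcingSet : ∀ {n} → Graph n → Subset n → Set
FailedZeroForcingSet G S = ¬ ZeroForcingSet G S

IsFailedZeroForcingNumber : ∀ {n} → Graph n → ℕ → Set
IsFailedZeroForcingNumber {n} G k =
  (∃[ S ] (FailedZeroForcingSet G S × ∣ S ∣ ≡ k)) ×
  (∀ (S : Subset n) → FailedZeroForcingSet G S → ∣ S ∣ ≤ k)

pathAdj : ∀ {t} → Fin t → Fin t → Bool
pathAdj i j = eqᵇ (suc (toℕ i)) (toℕ j) ∨ eqᵇ (suc (toℕ j)) (toℕ i)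

pathAdj-sym : ∀ {t} (i j : Fin t) → pathAdj i j ≡ pathAdj j i
pathAdj-sym i j = ∨-comm (eqᵇ (suc (toℕ i)) (toℕ j)) (eqᵇ (suc (toℕ j)) (toℕ i))

pathAdj-irrefl : ∀ {t} (i : Fin t) → pathAdj i i ≡ false
pathAdj-irrefl i rewrite eqᵇ-suc (toℕ i) = refl

Path : (t : ℕ) → Graph t
Path t = record { adj = pathAdj ; sym = pathAdj-sym ; irrefl = pathAdj-irrefl }

-- Cycle C_t (t ≥ 3): the path plus the edge {0, t-1}
wrapAdj : ∀ {t} → Fin t → Fin t → Bool
wrapAdj {t} i j = eqᵇ (toℕ i) 0 ∧ eqᵇ (suc (toℕ j)) t

cycleAdj : ∀ {t} → Fin t → Fin t → Bool
cycleAdj i j = pathAdj i j ∨ (wrapAdj i j ∨ wrapAdj j i)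

cycleAdj-sym : ∀ {t} (i j : Fin t) → cycleAdj i j ≡ cycleAdj j i
cycleAdj-sym i j = cong₂ _∨_ (pathAdj-sym i j) (∨-comm (wrapAdj i j) (wrapAdj j i))

private
  wrap-irrefl : ∀ t (m : ℕ) → 3 ≤ t → (eqᵇ m 0 ∧ eqᵇ (suc m) t) ≡ false
  wrap-irrefl t (suc m) _ = refl
  wrap-irrefl (suc (suc (suc t))) zero (s≤s (s≤s (s≤s z≤n))) = refl

cycleAdj-irrefl : ∀ {t} → 3 ≤ t → (i : Fin t) → cycleAdj i i ≡ false
cycleAdj-irrefl {t} h i rewrite pathAdj-irrefl i | wrap-irrefl t (toℕ i) h = refl

Cycle : (t : ℕ) → 3 ≤ t → Graph t
Cycle t h = record { adj = cycleAdj ; sym = cycleAdj-sym ; irrefl = cycleAdj-irrefl h }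

completeAdj : ∀ {t} → Fin t → Fin t → Bool
completeAdj i j = not (eqᵇ (toℕ i) (toℕ j))

Complete : (t : ℕ) → Graph t
Complete t = record
  { adj = completeAdj
  ; sym = λ i j → cong not (eqᵇ-sym (toℕ i) (toℕ j))
  ; irrefl = λ i → cong not (eqᵇ-refl (toℕ i)) }

-- Cartesian product G □ H on Fin (n * m); vertex x corresponds to the pair
-- remQuot m x = (u , v) ∈ Fin n × Fin m (a bijection, inverse Data.Fin.combine).
finEqᵇ : ∀ {k} → Fin k → Fin k → Bool
finEqᵇ a b = eqᵇ (toℕ a) (toℕ b)

pairAdj : ∀ {n m} → Graph n → Graph m → Fin n × Fin m → Fin n × Fin m → Bool
pairAdj G H (u , v) (u' , v') =
  (finEqᵇ u u' ∧ adj H v v') ∨ (finEqᵇ v v' ∧ adj G u u')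

pairAdj-sym : ∀ {n m} (G : Graph n) (H : Graph m) p q → pairAdj G H p q ≡ pairAdj G H q p
pairAdj-sym G H (u , v) (u' , v')
  rewrite eqᵇ-sym (toℕ u) (toℕ u') | eqᵇ-sym (toℕ v) (toℕ v')
        | Graph.sym G u u' | Graph.sym H v v' = refl

pairAdj-irrefl : ∀ {n m} (G : Graph n) (H : Graph m) p → pairAdj G H p p ≡ false
pairAdj-irrefl G H (u , v)
  rewrite eqᵇ-refl (toℕ u) | eqᵇ-refl (toℕ v) | Graph.irrefl G u | Graph.irrefl H v = refl

_□_ : ∀ {n m} → Graph n → Graph m → Graph (n Data.Nat.* m)
_□_ {n} {m} G H = record
  { adj = λ x y → pairAdj G H (remQuot m x) (remQuot m y)
  ; sym = λ x y → pairAdj-sym G H (remQuot m x) (remQuot m y)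
  ; irrefl = λ x → pairAdj-irrefl G H (remQuot m x) }

-- A set S is stalled when no force applies to it.  A stalled set that misses a vertex is
-- failed, and a failed set of maximum size is stalled (else forcing would enlarge it).
-- If S is stalled in G and T in H then S × T is stalled in G □ H, because every edge of
-- G □ H lies in a fibre, so a force in G □ H projects to a force in G or in H.  With S a
-- maximum failed set of G and T = V(H) this gives t F(G); with S = V(G) it gives n |T|
-- for any stalled T of H.  In P_t and C_t take T to be the odd vertices (excluding the
-- last vertex of the path), in K_t all vertices except 0 and 1: every vertex of T then has
-- two distinct neighbours outside T, so T is stalled.
module Submission where

open import Defs
open import Data.Nat using (ℕ; zero; suc; _+_; _*_; _∸_; _≤_; _<_; _⊔_; ⌈_/2⌉; ⌊_/2⌋; _<ᵇ_; _≤ᵇ_; _<?_; s≤s; z≤n)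
open import Data.Nat.Properties using (≤-trans; <-trans; <-irrefl; n<1+n; ≤-antisym; ≮⇒≥; *-comm; ⊔-lub; <⇒≱; <ᵇ⇒<)
open import Data.Bool using (Bool; true; false; _∧_; _∨_; not; if_then_else_)
open import Data.Bool.Properties using (∨-zeroʳ; ∧-conicalˡ; ∧-conicalʳ; not-injective; T-≡)
open import Data.Fin as Fin using (Fin; toℕ; combine; fromℕ<)
open import Data.Fin.Properties
  using (toℕ-injective; toℕ-fromℕ<; toℕ<n; fromℕ<-injective; remQuot-combine;
         combine-surjective; combine-injectiveˡ; combine-injectiveʳ)
open import Data.Fin.Subset using (Subset; _∈_; _∉_; _∪_; ⁅_⁆; ⊤; ⊥; ∁; ∣_∣)
open import Data.Fin.Subset.Properties
  using (∈⊤; ∣⊤∣≡n; ∣⊥∣≡0; x∈⁅x⁆; p⊆p∪q; x∈p∪q⁺; p⊂q⇒∣p∣<∣q∣; p∪∁p≡⊤; ∪-identityʳ;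
         nonempty?; Empty-unique; x∈∁p⇒x∉p)
open import Data.Vec using ([]; _∷_; _++_; concat; map; lookup; tabulate)
open import Data.Vec.Properties
  using (lookup-concat; lookup-map; lookup-replicate; lookup∘tabulate; []=⇒lookup; lookup⇒[]=)
open import Data.Product using (_×_; _,_; ∃; ∃₂; proj₁; proj₂)
open import Data.Sum using (_⊎_; inj₁; inj₂)
open import Function using (_∘_; flip; Equivalence)
open import Relation.Nullary using (¬_; yes; no; contradiction)
open import Relation.Binary.PropositionalEquality
open import Relation.Binary.Construct.Closure.ReflexiveTransitive using (Star; ε; _◅_)

private
  variable
    n t m : ℕ

∧-falseˡ : ∀ {a b} → a ≡ false → a ∧ b ≡ false
∧-falseˡ refl = refl

∨-trueˡ : ∀ {a b} → a ≡ true → a ∨ b ≡ true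
∨-trueˡ refl = refl

∧-∨-∧-split : ∀ a b c d → (a ∧ b) ∨ (c ∧ d) ≡ true → (a ≡ true × b ≡ true) ⊎ (c ≡ true × d ≡ true)
∧-∨-∧-split true  true  _ _ _ = inj₁ (refl , refl)
∧-∨-∧-split true  false c d e = inj₂ (∧-conicalˡ c d e , ∧-conicalʳ c d e)
∧-∨-∧-split false _     c d e = inj₂ (∧-conicalˡ c d e , ∧-conicalʳ c d e)

eqᵇ⇒≡ : ∀ i j → eqᵇ i j ≡ true → i ≡ j
eqᵇ⇒≡ zero    zero    _ = refl
eqᵇ⇒≡ (suc i) (suc j) e = cong suc (eqᵇ⇒≡ i j e)

finEqᵇ⇒≡ : ∀ (u w : Fin n) → finEqᵇ u w ≡ true → u ≡ w
finEqᵇ⇒≡ u w e = toℕ-injective (eqᵇ⇒≡ (toℕ u) (toℕ w) e)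

Stalled : Graph n → Subset n → Set
Stalled G S = ∀ {S′} → ¬ Force G S S′

⊤-stalled : ∀ {G : Graph n} → Stalled G ⊤
⊤-stalled (force _ _ _ v∉⊤ _ _) = v∉⊤ ∈⊤

stalled⇒failed : ∀ {G : Graph n} {S u} → Stalled G S → u ∉ S → FailedZeroForcingSet G S
stalled⇒failed _         u∉S ε       = u∉S ∈⊤
stalled⇒failed S-stalled _   (f ◅ _) = S-stalled f

stalled⇒≤failedNumber : ∀ {G : Graph n} {S u} → Stalled G S → u ∉ S →
                         IsFailedZeroForcingNumber G m → ∣ S ∣ ≤ m
stalled⇒≤failedNumber S-stalled u∉S (_ , max) = max _ (stalled⇒failed S-stalled u∉S)

maximumFailed⇒stalled : ∀ {G : Graph n} {S} → FailedZeroForcingSet G S →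
                        (∀ S′ → FailedZeroForcingSet G S′ → ∣ S′ ∣ ≤ ∣ S ∣) → Stalled G S
maximumFailed⇒stalled {S = S} S-failed S-max f@(force _ v _ v∉S _ _) =
  <⇒≱ ∣S∣<∣S∪v∣ (S-max (S ∪ ⁅ v ⁆) (S-failed ∘ (f ◅_)))
  where
  ∣S∣<∣S∪v∣ : ∣ S ∣ < ∣ S ∪ ⁅ v ⁆ ∣
  ∣S∣<∣S∪v∣ = p⊂q⇒∣p∣<∣q∣ (p⊆p∪q ⁅ v ⁆ , v , x∈p∪q⁺ (inj₂ (x∈⁅x⁆ v)) , v∉S)

failed⇒nonfull : ∀ {G : Graph n} {S} → FailedZeroForcingSet G S → ∃ λ u → u ∉ S
failed⇒nonfull {G = G} {S} S-failed with nonempty? (∁ S)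
... | yes (u , u∈∁S) = u , x∈∁p⇒x∉p u∈∁S
... | no ∁S-empty    = contradiction (subst (λ X → Star (Force G) X ⊤) (sym S≡⊤) ε) S-failed
  where
  open ≡-Reasoning
  S≡⊤ : S ≡ ⊤
  S≡⊤ = begin
    S         ≡⟨ ∪-identityʳ S ⟨
    S ∪ ⊥     ≡⟨ cong (S ∪_) (Empty-unique ∁S-empty) ⟨
    S ∪ ∁ S   ≡⟨ p∪∁p≡⊤ S ⟩
    ⊤         ∎

_⊠_ : Subset n → Subset t → Subset (n * t)
S ⊠ T = concat (map (λ b → if b then T else ⊥) S)

∣p++q∣≡∣p∣+∣q∣ : ∀ (p : Subset n) (q : Subset t) → ∣ p ++ q ∣ ≡ ∣ p ∣ + ∣ q ∣
∣p++q∣≡∣p∣+∣q∣ []          q = refl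
∣p++q∣≡∣p∣+∣q∣ (true  ∷ p) q = cong suc (∣p++q∣≡∣p∣+∣q∣ p q)
∣p++q∣≡∣p∣+∣q∣ (false ∷ p) q = ∣p++q∣≡∣p∣+∣q∣ p q

∣S⊠T∣≡∣S∣*∣T∣ : ∀ (S : Subset n) (T : Subset t) → ∣ S ⊠ T ∣ ≡ ∣ S ∣ * ∣ T ∣
∣S⊠T∣≡∣S∣*∣T∣ []          T = refl
∣S⊠T∣≡∣S∣*∣T∣ (true  ∷ S) T =
  trans (∣p++q∣≡∣p∣+∣q∣ T (S ⊠ T)) (cong (∣ T ∣ +_) (∣S⊠T∣≡∣S∣*∣T∣ S T))
∣S⊠T∣≡∣S∣*∣T∣ {t = t} (false ∷ S) T =
  trans (∣p++q∣≡∣p∣+∣q∣ (⊥ {n = t}) (S ⊠ T)) (cong₂ _+_ (∣⊥∣≡0 t) (∣S⊠T∣≡∣S∣*∣T∣ S T))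

lookup-⊠ : ∀ (S : Subset n) (T : Subset t) u v →
           lookup (S ⊠ T) (combine u v) ≡ lookup S u ∧ lookup T v
lookup-⊠ S T u v = begin
  lookup (S ⊠ T) (combine u v)       ≡⟨ lookup-concat (map row S) u v ⟩
  lookup (lookup (map row S) u) v    ≡⟨ cong (λ r → lookup r v) (lookup-map u row S) ⟩
  lookup (row (lookup S u)) v        ≡⟨ lookup-row (lookup S u) ⟩
  lookup S u ∧ lookup T v            ∎
  where
  open ≡-Reasoning
  row : Bool → Subset _
  row b = if b then T else ⊥
  lookup-row : ∀ b → lookup (row b) v ≡ b ∧ lookup T v
  lookup-row true  = refl
  lookup-row false = lookup-replicate v false

⊠-∈⁺ : ∀ {S : Subset n} {T : Subset t} {u v} → u ∈ S → v ∈ T → combine u v ∈ S ⊠ T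
⊠-∈⁺ {S = S} {T} {u} {v} u∈S v∈T = lookup⇒[]= (combine u v) (S ⊠ T)
  (trans (lookup-⊠ S T u v) (cong₂ _∧_ ([]=⇒lookup u∈S) ([]=⇒lookup v∈T)))

⊠-∈⁻ : ∀ {S : Subset n} {T : Subset t} {u v} → combine u v ∈ S ⊠ T → u ∈ S × v ∈ T
⊠-∈⁻ {S = S} {T} {u} {v} uv∈ =
    lookup⇒[]= u S (∧-conicalˡ (lookup S u) (lookup T v) both)
  , lookup⇒[]= v T (∧-conicalʳ (lookup S u) (lookup T v) both)
  where
  both : lookup S u ∧ lookup T v ≡ true
  both = trans (sym (lookup-⊠ S T u v)) ([]=⇒lookup uv∈)

⊠-∉ˡ : ∀ {S : Subset n} {T : Subset t} {u v} → u ∉ S → combine u v ∉ S ⊠ T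
⊠-∉ˡ {S = S} {T} {u} {v} u∉S = u∉S ∘ proj₁ ∘ ⊠-∈⁻ {S = S} {T} {u} {v}

⊠-∉ʳ : ∀ {S : Subset n} {T : Subset t} {u v} → v ∉ T → combine u v ∉ S ⊠ T
⊠-∉ʳ {S = S} {T} {u} {v} v∉T = v∉T ∘ proj₂ ∘ ⊠-∈⁻ {S = S} {T} {u} {v}

module _ {G : Graph n} {H : Graph t} where

  □-adj : ∀ u v u′ v′ → adj (G □ H) (combine u v) (combine u′ v′) ≡ pairAdj G H (u , v) (u′ , v′)
  □-adj u v u′ v′ = cong₂ (pairAdj G H) (remQuot-combine u v) (remQuot-combine u′ v′)

  □-adjˡ : ∀ {u u′} v → adj G u u′ ≡ true → adj (G □ H) (combine u v) (combine u′ v) ≡ true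
  □-adjˡ {u} {u′} v uu′ rewrite □-adj u v u′ v | eqᵇ-refl (toℕ v) | uu′ = ∨-zeroʳ _

  □-adjʳ : ∀ u {v v′} → adj H v v′ ≡ true → adj (G □ H) (combine u v) (combine u v′) ≡ true
  □-adjʳ u {v} {v′} vv′ rewrite □-adj u v u v′ | eqᵇ-refl (toℕ u) | vv′ = refl

  □-adj⁻ : ∀ u v u′ v′ → adj (G □ H) (combine u v) (combine u′ v′) ≡ true →
           (u ≡ u′ × adj H v v′ ≡ true) ⊎ (v ≡ v′ × adj G u u′ ≡ true)
  □-adj⁻ u v u′ v′ e with ∧-∨-∧-split (finEqᵇ u u′) _ (finEqᵇ v v′) _ (trans (sym (□-adj u v u′ v′)) e)
  ... | inj₁ (uu′ , vv′) = inj₁ (finEqᵇ⇒≡ u u′ uu′ , vv′)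
  ... | inj₂ (vv′ , uu′) = inj₂ (finEqᵇ⇒≡ v v′ vv′ , uu′)

  ⊠-stalled : ∀ {S T} → Stalled G S → Stalled H T → Stalled (G □ H) (S ⊠ T)
  ⊠-stalled {S} {T} S-stalled T-stalled (force x y x∈ y∉ xy unique)
    with combine-surjective {n} {t} x | combine-surjective {n} {t} y
  ... | u , v , refl | u′ , v′ , refl with ⊠-∈⁻ {S = S} {T} x∈ | □-adj⁻ u v u′ v′ xy
  ... | u∈S , v∈T | inj₁ (refl , vv′) =
    T-stalled (force v v′ v∈T (y∉ ∘ ⊠-∈⁺ u∈S) vv′ λ w vw w∉T →
      combine-injectiveʳ u w u v′ (unique (combine u w) (□-adjʳ u vw) (⊠-∉ʳ {S = S} w∉T)))
  ... | u∈S , v∈T | inj₂ (refl , uu′) =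
    S-stalled (force u u′ u∈S (y∉ ∘ flip ⊠-∈⁺ v∈T) uu′ λ w uw w∉S →
      combine-injectiveˡ w v u′ v (unique (combine w v) (□-adjˡ v uw) (⊠-∉ˡ {T = T} w∉S)))

  □-failedNumber-lowerBound : ∀ {S T u v} → Stalled G S → u ∉ S → Stalled H T → v ∉ T →
                              IsFailedZeroForcingNumber (G □ H) m → t * ∣ S ∣ ⊔ n * ∣ T ∣ ≤ m
  □-failedNumber-lowerBound {m} {S} {T} {u} {v} S-stalled u∉S T-stalled v∉T F = ⊔-lub
    (subst (_≤ m) ∣S⊠⊤∣ (stalled⇒≤failedNumber (⊠-stalled S-stalled (⊤-stalled {G = H}))
                                                (⊠-∉ˡ {T = ⊤} {v = v} u∉S) F))
    (subst (_≤ m) ∣⊤⊠T∣ (stalled⇒≤failedNumber (⊠-stalled (⊤-stalled {G = G}) T-stalled)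
                                                (⊠-∉ʳ {S = ⊤} {u = u} v∉T) F))
    where
    ∣S⊠⊤∣ : ∣ S ⊠ ⊤ {t} ∣ ≡ t * ∣ S ∣
    ∣S⊠⊤∣ = trans (∣S⊠T∣≡∣S∣*∣T∣ S ⊤) (trans (cong (∣ S ∣ *_) (∣⊤∣≡n t)) (*-comm ∣ S ∣ t))
    ∣⊤⊠T∣ : ∣ ⊤ {n} ⊠ T ∣ ≡ n * ∣ T ∣
    ∣⊤⊠T∣ = trans (∣S⊠T∣≡∣S∣*∣T∣ (⊤ {n}) T) (cong (_* ∣ T ∣) (∣⊤∣≡n n))

OutsideNeighbour : Graph n → Subset n → Fin n → Fin n → Set
OutsideNeighbour G S u w = adj G u w ≡ true × w ∉ S

TwoOutsideNeighbours : Graph n → Subset n → Fin n → Set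
TwoOutsideNeighbours G S u =
  ∃₂ λ w w′ → w ≢ w′ × OutsideNeighbour G S u w × OutsideNeighbour G S u w′

twoOutsideNeighbours⇒stalled : ∀ {G : Graph n} {S} →
  (∀ u → u ∈ S → TwoOutsideNeighbours G S u) → Stalled G S
twoOutsideNeighbours⇒stalled two (force u _ u∈S _ _ unique) with two u u∈S
... | w , w′ , w≢w′ , (uw , w∉S) , (uw′ , w′∉S) =
  w≢w′ (trans (unique w uw w∉S) (sym (unique w′ uw′ w′∉S)))

subsetOf : (ℕ → Bool) → Subset t
subsetOf p = tabulate (λ i → p (toℕ i))

∈-subsetOf⁻ : ∀ p {i : Fin t} → i ∈ subsetOf p → p (toℕ i) ≡ true
∈-subsetOf⁻ p {i} i∈ = trans (sym (lookup∘tabulate (λ j → p (toℕ j)) i)) ([]=⇒lookup i∈)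

∉-subsetOf : ∀ p {i : Fin t} → p (toℕ i) ≡ false → i ∉ subsetOf p
∉-subsetOf p pi≡false i∈ with trans (sym pi≡false) (∈-subsetOf⁻ p i∈)
... | ()

OutsideNeighbourℕ : ℕ → (ℕ → ℕ → Bool) → (ℕ → Bool) → ℕ → ℕ → Set
OutsideNeighbourℕ t A p i a = a < t × A i a ≡ true × p a ≡ false

TwoOutsideNeighboursℕ : ℕ → (ℕ → ℕ → Bool) → (ℕ → Bool) → ℕ → Set
TwoOutsideNeighboursℕ t A p i =
  ∃₂ λ a b → a ≢ b × OutsideNeighbourℕ t A p i a × OutsideNeighbourℕ t A p i b

module _ (H : Graph t) (A : ℕ → ℕ → Bool) (adj≡A : ∀ u w → adj H u w ≡ A (toℕ u) (toℕ w))
         (p : ℕ → Bool) where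

  outsideNeighbour-fromℕ : ∀ {u a} (a<t : a < t) → OutsideNeighbourℕ t A p (toℕ u) a →
                           OutsideNeighbour H (subsetOf p) u (fromℕ< a<t)
  outsideNeighbour-fromℕ {u} a<t (_ , ua , pa) =
      trans (adj≡A u _) (subst (λ x → A (toℕ u) x ≡ true) (sym (toℕ-fromℕ< a<t)) ua)
    , ∉-subsetOf p (subst (λ x → p x ≡ false) (sym (toℕ-fromℕ< a<t)) pa)

  subsetOf-stalled : (∀ i → i < t → p i ≡ true → TwoOutsideNeighboursℕ t A p i) →
                     Stalled H (subsetOf p)
  subsetOf-stalled two = twoOutsideNeighbours⇒stalled λ u u∈ →
    let a , b , a≢b , na@(a<t , _) , nb@(b<t , _) = two (toℕ u) (toℕ<n u) (∈-subsetOf⁻ p u∈)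
    in  fromℕ< a<t , fromℕ< b<t , a≢b ∘ fromℕ<-injective a b a<t b<t
      , outsideNeighbour-fromℕ a<t na , outsideNeighbour-fromℕ b<t nb

odd : ℕ → Bool
odd zero          = false
odd (suc zero)    = true
odd (suc (suc i)) = odd i

odd-suc : ∀ i → odd (suc i) ≡ not (odd i)
odd-suc zero          = refl
odd-suc (suc zero)    = refl
odd-suc (suc (suc i)) = odd-suc i

odd-pred : ∀ i → odd (suc i) ≡ true → odd i ≡ false
odd-pred i e = not-injective (trans (sym (odd-suc i)) e)

pathAdjℕ : ℕ → ℕ → Bool
pathAdjℕ i j = eqᵇ (suc i) j ∨ eqᵇ (suc j) i

pathAdjℕ-suc : ∀ i → pathAdjℕ i (suc i) ≡ true
pathAdjℕ-suc i rewrite eqᵇ-refl i = refl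

pathAdjℕ-pred : ∀ i → pathAdjℕ (suc i) i ≡ true
pathAdjℕ-pred i rewrite eqᵇ-refl i = ∨-zeroʳ _

cycleAdjℕ : ℕ → ℕ → ℕ → Bool
cycleAdjℕ t i j = pathAdjℕ i j ∨ (wrap i j ∨ wrap j i)
  where
  wrap : ℕ → ℕ → Bool
  wrap i j = eqᵇ i 0 ∧ eqᵇ (suc j) t

cycleAdjℕ-wrap : ∀ j → cycleAdjℕ (suc (suc j)) (suc j) 0 ≡ true
cycleAdjℕ-wrap j rewrite eqᵇ-refl j = ∨-zeroʳ _

completeAdjℕ : ℕ → ℕ → Bool
completeAdjℕ i j = not (eqᵇ i j)

pathBlue : ℕ → ℕ → Bool
pathBlue t i = odd i ∧ (suc i <ᵇ t)

pathBlue-neighbours : ∀ t i → i < t → pathBlue t i ≡ true →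
                      TwoOutsideNeighboursℕ t pathAdjℕ (pathBlue t) i
pathBlue-neighbours t (suc j) sj<t blue =
  j , suc (suc j) , (λ ())
    , (<-trans (n<1+n j) sj<t , pathAdjℕ-pred j , ∧-falseˡ j-even)
    , (ssj<t , pathAdjℕ-suc (suc j) , ∧-falseˡ j-even)
  where
  j-even : odd j ≡ false
  j-even = odd-pred j (∧-conicalˡ _ _ blue)
  ssj<t : suc (suc j) < t
  ssj<t = <ᵇ⇒< _ _ (Equivalence.from T-≡ (∧-conicalʳ _ _ blue))

cycle-upperNeighbour : ∀ t → 3 ≤ t → ∀ j → suc j < t → odd j ≡ false →
                       ∃ λ b → j ≢ b × OutsideNeighbourℕ t (cycleAdjℕ t) odd (suc j) b
cycle-upperNeighbour t 3≤t j sj<t j-even with suc (suc j) <? t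
... | yes ssj<t = suc (suc j) , (λ ()) , ssj<t , ∨-trueˡ (pathAdjℕ-suc (suc j)) , j-even
... | no ssj≮t  = 0 , j≢0 , ≤-trans (s≤s z≤n) sj<t , wrap , refl
  where
  t≡ssj : t ≡ suc (suc j)
  t≡ssj = ≤-antisym (≮⇒≥ ssj≮t) sj<t
  j≢0 : j ≢ 0
  j≢0 refl = <-irrefl refl (subst (2 <_) t≡ssj 3≤t)
  wrap : cycleAdjℕ t (suc j) 0 ≡ true
  wrap = subst (λ s → cycleAdjℕ s (suc j) 0 ≡ true) (sym t≡ssj) (cycleAdjℕ-wrap j)

odd-neighbours : ∀ t → 3 ≤ t → ∀ i → i < t → odd i ≡ true →
                 TwoOutsideNeighboursℕ t (cycleAdjℕ t) odd i
odd-neighbours t 3≤t (suc j) sj<t sj-odd =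
  let b , j≢b , upper = cycle-upperNeighbour t 3≤t j sj<t j-even
  in  j , b , j≢b , (<-trans (n<1+n j) sj<t , ∨-trueˡ (pathAdjℕ-pred j) , j-even) , upper
  where
  j-even : odd j ≡ false
  j-even = odd-pred j sj-odd

atLeast2-neighbours : ∀ t i → i < t → (2 ≤ᵇ i) ≡ true → TwoOutsideNeighboursℕ t completeAdjℕ (2 ≤ᵇ_) i
atLeast2-neighbours t (suc (suc j)) ssj<t _ =
  0 , 1 , (λ ()) , (≤-trans (s≤s z≤n) ssj<t , refl , refl) , (≤-trans (s≤s (s≤s z≤n)) ssj<t , refl , refl)

path-stalled : ∀ t → Stalled (Path t) (subsetOf (pathBlue t))
path-stalled t = subsetOf-stalled (Path t) pathAdjℕ (λ _ _ → refl) (pathBlue t) (pathBlue-neighbours t)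

cycle-stalled : ∀ t (3≤t : 3 ≤ t) → Stalled (Cycle t 3≤t) (subsetOf odd)
cycle-stalled t 3≤t = subsetOf-stalled (Cycle t 3≤t) (cycleAdjℕ t) (λ _ _ → refl) odd (odd-neighbours t 3≤t)

complete-stalled : ∀ t → Stalled (Complete t) (subsetOf (2 ≤ᵇ_))
complete-stalled t = subsetOf-stalled (Complete t) completeAdjℕ (λ _ _ → refl) (2 ≤ᵇ_) (atLeast2-neighbours t)

∣pathBlue∣ : ∀ t → ∣ subsetOf {t} (pathBlue t) ∣ ≡ ⌈ (t ∸ 2) /2⌉
∣pathBlue∣ 0 = refl
∣pathBlue∣ 1 = refl
∣pathBlue∣ 2 = refl
∣pathBlue∣ 3 = refl
∣pathBlue∣ (suc (suc (suc (suc t)))) = cong suc (∣pathBlue∣ (suc (suc t)))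

∣odd∣ : ∀ t → ∣ subsetOf {t} odd ∣ ≡ ⌊ t /2⌋
∣odd∣ 0             = refl
∣odd∣ 1             = refl
∣odd∣ (suc (suc t)) = cong suc (∣odd∣ t)

∣atLeast2∣ : ∀ t → ∣ subsetOf {t} (2 ≤ᵇ_) ∣ ≡ t ∸ 2
∣atLeast2∣ 0             = refl
∣atLeast2∣ 1             = refl
∣atLeast2∣ (suc (suc t)) = ∣all∣ t
  where
  ∣all∣ : ∀ t → ∣ subsetOf {t} (λ _ → true) ∣ ≡ t
  ∣all∣ zero    = refl
  ∣all∣ (suc t) = cong suc (∣all∣ t)

proposition3p1 : ∀ {n : ℕ} (G : Graph n) (t : ℕ) → 1 ≤ t → ∀ (k : ℕ) →
    IsFailedZeroForcingNumber G k →
    (∀ m → IsFailedZeroForcingNumber (G □ Path t) m →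
       (t * k) ⊔ (n * ⌈ (t ∸ 2) /2⌉) ≤ m)
    × (∀ (h : 3 ≤ t) m → IsFailedZeroForcingNumber (G □ Cycle t h) m →
       (t * k) ⊔ (n * ⌊ t /2⌋) ≤ m)
    × (∀ m → IsFailedZeroForcingNumber (G □ Complete t) m →
       (t * k) ⊔ (n * (t ∸ 2)) ≤ m)
proposition3p1 {n} G t@(suc _) _ _ ((S , S-failed , refl) , S-max) =
    bound (∣pathBlue∣ t) (path-stalled t) (∉-subsetOf (pathBlue t) refl)
  , (λ 3≤t → bound (∣odd∣ t) (cycle-stalled t 3≤t) (∉-subsetOf odd refl))
  , bound (∣atLeast2∣ t) (complete-stalled t) (∉-subsetOf (2 ≤ᵇ_) refl)
  where
  bound : ∀ {H : Graph t} {T c} → ∣ T ∣ ≡ c → Stalled H T → Fin.zero ∉ T →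
          ∀ m → IsFailedZeroForcingNumber (G □ H) m → t * ∣ S ∣ ⊔ n * c ≤ m
  bound refl T-stalled 0∉T _ =
    □-failedNumber-lowerBound (maximumFailed⇒stalled S-failed S-max)
      (proj₂ (failed⇒nonfull S-failed)) T-stalled 0∉T
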